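{- Let $\{A_i\}_{i\in I}$ be a finite set of agents agreeing on $CV$, $D$, $Ch$. Let $S=\langle\mathcal V,\rho,\theta\rangle$ be their discrete-system representation and $\mathcal T=\|_{i\in I}\mathcal T(A_i)$ the parallel composition of their CTS semantics, with initial states $S_0$ and transition relation $R_{\mathcal T}$. Then: (1) for every assignment $s$ to $\mathcal V$, $\theta(s)$ holds iff $s\in S_0$; (2) for all assignments $s$ to $\mathcal V$ and $s'$ to $\mathcal V'$, $\rho(s,s')$ holds iff there exist an assignment $\mathbf d$ to the data variables, a channel $ch$ and an agent $i$ such that $(s,(\mathbf d,i,\pi,!,ch),s')\in R_{\mathcal T}$ (for the corresponding $\pi$).
   Context: Channelled transition systems (CTS): $\mathcal T=\langle C,\Sigma,\Upsilon,S,S_0,R,L,ls\rangle$ where $C$ is a set of channels containing the broadcast channel $\star$, $\Upsilon=\Upsilon^+\times\{!,?\}\times C$, $R\subseteq S\times\Upsilon\times S$, $L:S\to\Sigma$, $ls:S\to 2^C$ with $\star\in ls(s)$ for all $s$. Parallel composition $\mathcal T_1\|\mathcal T_2$: channels $C_1\cup C_2$, states $S_1\times S_2$, initial states $S^1_0\times S^2_0$, labels $L(s_1,s_2)=(L_1(s_1),L_2(s_2))$, $ls(s_1,s_2)=ls^1(s_1)\cup ls^2(s_2)$, and $R$ consists of: (a) $((s_1,s_2),(\upsilon,!,c),(s_1',s_2'))$ whenever [$(s_1,(\upsilon,!,c),s_1')\in R_1$ and $(s_2,(\upsilon,?,c),s_2')\in R_2$] or [$(s_1,(\upsilon,?,c),s_1')\in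 R_1$ and $(s_2,(\upsilon,!,c),s_2')\in R_2$] or [$(s_1,(\upsilon,!,c),s_1')\in R_1$, $c\notin ls^2(s_2)$, $s_2=s_2'$] or [$c\notin ls^1(s_1)$, $s_1=s_1'$, $(s_2,(\upsilon,!,c),s_2')\in R_2$]; (b) $((s_1,s_2),(\upsilon,?,c),(s_1',s_2'))$ whenever both make $(\upsilon,?,c)$ transitions, or one does and the other has $c\notin ls$ and stays; (c) $((s_1,s_2),(\upsilon,\gamma,\star),(s_1',s_2'))$ for $\gamma\in\{!,?\}$ whenever one component makes $(\upsilon,\gamma,\star)$, the other stays and has no $(\upsilon,?,\star)$ transition from its current state. Agents: fix common variables $CV$, data variables $D$, channels $Ch\ni\star$, identities $K$. An agent $A_i=\langle V_i,f_i,g^s_i,g^r_i,T^s_i,T^r_i,\theta_i\rangle$ has finite-domain local variables $V_i$ (states are assignments to $V_i$), a renaming $f_i:CV\to V_i$ (also read as the assertion $\bigwedge_{cv}cv=f_i(cv)$), a send guard $g^s_i(V_i,Ch,D,CV)$, a receive guard $g^r_i(V_i,Ch)$ with $g^r_i(V_i,\star)=\mathrm{true}$, send and receive transition assertions $T^s_i(V_i,V_i',D,Ch)$, $T^r_i(V_i,V_i',D,Ch)$ with $T^r_i$ broadcast-input-enabled ($\forall v,\mathbf d\,\exists v': T^r_i(v,v',\mathbf d,\star)$), and an initial assertion $\theta_i$; $\mathrm{Id}_i$ denotes $\bigwedge_{v\in V_i}v=v'$. Its CTS $\mathcal T(A_i)$ has channels $Ch$, states = initial-state alphabet = assignments to $V_i$,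 initial states those satisfying $\theta_i$, $ls(s)=\{c\mid g^r_i(s,c)\}$, and transitions $(s,(\mathbf d,i,\pi,!,c),s')$ iff $T^s_i(s,s',\mathbf d,c)$ and $\pi=g^s_i(s,c,\mathbf d)$ (a predicate over $CV$), and $(s,(\mathbf d,i',\pi,?,c),s')$ iff $T^r_i(s,s',\mathbf d,c)$, $i'\ne i$, $c\in ls(s)$ and $\pi$ holds under the assignment $cv\mapsto s(f_i(cv))$. Discrete system: $\mathcal V=\bigcup_i V_i$, $\theta=\bigwedge_i\theta_i$, and $\rho:=\exists ch\,\exists D\ \bigvee_k\Big(T^s_k(V_k,V_k',D,ch)\wedge\bigwedge_{j\ne k}\exists CV.\big(f_j\wedge[(g^r_j(V_j,ch)\wedge T^r_j(V_j,V_j',D,ch)\wedge g^s_k(V_k,ch,D,CV))\vee(\neg g^r_j(V_j,ch)\wedge\mathrm{Id}_j)\vee(ch=\star\wedge\neg g^s_k(V_k,ch,D,CV)\wedge\mathrm{Id}_j)]\big)\Big)$. -}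

module Defs where

open import Data.Nat using (ℕ; zero; suc)
open import Data.Fin using (Fin; zero; suc)
open import Data.Product using (Σ; ∃; _×_; _,_; proj₁; proj₂)
open import Data.Sum using (_⊎_)
open import Relation.Nullary using (¬_)
open import Relation.Binary.PropositionalEquality using (_≡_; _≢_)
open import Function using (_∘_)
open import Function.Bundles using (_↔_)
open import Level using (Lift; 0ℓ) renaming (suc to lsuc)

data Dir : Set where
  snd rcv : Dir

-- Channelled transition systems over a channel set Ch containing the
-- broadcast channel ⋆ and with message part Υ⁺ = M.  A label
-- (υ , γ , c) ∈ Υ = Υ⁺ × {!,?} × C is written curried: R s υ γ c s'.
-- All systems considered share the same channel set Ch (C₁ ∪ C₂ = Ch).

module CTSs (Ch : Set) (⋆ : Ch) (M : Set₁) where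

  record CTS : Set₂ where
    field
      Alph  : Set
      State : Set
      Init  : State → Set
      R     : State → M → Dir → Ch → State → Set₁
      L     : State → Alph
      ls    : State → Ch → Set
      ls⋆   : ∀ s → ls s ⋆

  open CTS

  _∥_ : CTS → CTS → CTS
  Alph  (T₁ ∥ T₂) = Alph T₁ × Alph T₂
  State (T₁ ∥ T₂) = State T₁ × State T₂
  Init  (T₁ ∥ T₂) (s₁ , s₂) = Init T₁ s₁ × Init T₂ s₂
  L     (T₁ ∥ T₂) (s₁ , s₂) = L T₁ s₁ , L T₂ s₂
  ls    (T₁ ∥ T₂) (s₁ , s₂) c = ls T₁ s₁ c ⊎ ls T₂ s₂ c
  ls⋆   (T₁ ∥ T₂) (s₁ , s₂) = Data.Sum.inj₁ (ls⋆ T₁ s₁)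
  -- (a) together with (c) for γ = !
  R (T₁ ∥ T₂) (s₁ , s₂) υ snd c (s₁' , s₂') =
      (R T₁ s₁ υ snd c s₁' × R T₂ s₂ υ rcv c s₂')
    ⊎ (R T₁ s₁ υ rcv c s₁' × R T₂ s₂ υ snd c s₂')
    ⊎ (R T₁ s₁ υ snd c s₁' × ¬ ls T₂ s₂ c × s₂ ≡ s₂')
    ⊎ (¬ ls T₁ s₁ c × s₁ ≡ s₁' × R T₂ s₂ υ snd c s₂')
    ⊎ (c ≡ ⋆ ×
        ( (R T₁ s₁ υ snd c s₁' × s₂ ≡ s₂' × ¬ (∃ λ t → R T₂ s₂ υ rcv c t))
        ⊎ (R T₂ s₂ υ snd c s₂' × s₁ ≡ s₁' × ¬ (∃ λ t → R T₁ s₁ υ rcv c t))))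
  -- (b) together with (c) for γ = ?
  R (T₁ ∥ T₂) (s₁ , s₂) υ rcv c (s₁' , s₂') =
      (R T₁ s₁ υ rcv c s₁' × R T₂ s₂ υ rcv c s₂')
    ⊎ (R T₁ s₁ υ rcv c s₁' × ¬ ls T₂ s₂ c × s₂ ≡ s₂')
    ⊎ (¬ ls T₁ s₁ c × s₁ ≡ s₁' × R T₂ s₂ υ rcv c s₂')
    ⊎ (c ≡ ⋆ ×
        ( (R T₁ s₁ υ rcv c s₁' × s₂ ≡ s₂' × ¬ (∃ λ t → R T₂ s₂ υ rcv c t))
        ⊎ (R T₂ s₂ υ rcv c s₂' × s₁ ≡ s₁' × ¬ (∃ λ t → R T₁ s₁ υ rcv c t))))

  ∥[_] : ∀ n → (Fin (suc n) → CTS) → CTS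
  ∥[ zero ]  T = T zero
  ∥[ suc n ] T = T zero ∥ ∥[ n ] (T ∘ suc)

  pack : ∀ n (T : Fin (suc n) → CTS) → ((i : Fin (suc n)) → State (T i))
       → State (∥[ n ] T)
  pack zero    T s = s zero
  pack (suc n) T s = s zero , pack n (T ∘ suc) (s ∘ suc)

-- Agents.  CVA = type of assignments to the common variables CV,
-- DA = type of assignments to the data variables D, Ch ∋ ⋆ channels.
-- The set of agents (and of identities) is I = Fin (suc n).

module Agents (CVA DA Ch : Set) (⋆ : Ch) (n : ℕ) where

  I : Set
  I = Fin (suc n)

  record Agent : Set₁ where
    field
      St     : Set                         -- assignments to V_i
      finite : Σ ℕ λ m → (St ↔ Fin m)
      f      : St → CVA                    -- cv ↦ s(f_i(cv)), induced by the renaming f_i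
      gs     : St → Ch → DA → CVA → Set
      gr     : St → Ch → Set
      gr⋆    : ∀ s → gr s ⋆
      Ts     : St → St → DA → Ch → Set
      Tr     : St → St → DA → Ch → Set
      Tr-en  : ∀ v d → ∃ λ v' → Tr v v' d ⋆
      θ      : St → Set

  -- Υ⁺ : (data assignment, identity, predicate π over CV)
  Msg : Set₁
  Msg = DA × I × (CVA → Set)

  open CTSs Ch ⋆ Msg public

  ⟦_⟧ : Agent → I → CTS
  ⟦ A ⟧ i = record
    { Alph  = St
    ; State = St
    ; Init  = θ
    ; R     = Rel
    ; L     = λ s → s
    ; ls    = gr
    ; ls⋆   = gr⋆
    }
    where
      open Agent A
      Rel : St → Msg → Dir → Ch → St → Set₁
      Rel s (d , i' , π) snd c s' = Lift (lsuc 0ℓ) (Ts s s' d c × i' ≡ i) × π ≡ gs s c d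
      Rel s (d , i' , π) rcv c s' = Lift (lsuc 0ℓ) (Tr s s' d c × i' ≢ i × gr s c × π (f s))

  module _ (A : I → Agent) where
    open Agent

    sys : CTS
    sys = ∥[ n ] (λ i → ⟦ A i ⟧ i)

    -- assignments to 𝒱 = ⋃_i V_i
    Glob : Set
    Glob = (i : I) → St (A i)

    toState : Glob → CTS.State sys
    toState s = pack n (λ i → ⟦ A i ⟧ i) s

    θS : Glob → Set
    θS s = ∀ i → θ (A i) (s i)

    ρ : Glob → Glob → Set
    ρ s s' = Σ Ch λ ch → Σ DA λ d → Σ I λ k →
      Ts (A k) (s k) (s' k) d ch ×
      (∀ j → j ≢ k → Σ CVA λ cv → cv ≡ f (A j) (s j) ×
         ( (gr (A j) (s j) ch × Tr (A j) (s j) (s' j) d ch × gs (A k) (s k) ch d cv)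
         ⊎ (¬ gr (A j) (s j) ch × s j ≡ s' j)
         ⊎ (ch ≡ ⋆ × ¬ gs (A k) (s k) ch d cv × s j ≡ s' j)))

-- A send step of the composition is a send step of one component k in which
-- every other component j "reacts" to the message: it receives it, or does not
-- listen on the channel and stays, or (broadcast only) stays because it has no
-- matching receive.  For the binary composition this is a case split on the
-- clauses (a)-(c); it lifts to the n-ary composition because "reacting" is
-- itself preserved and reflected by ∥.  For an agent j, reacting to a message
-- guarded by π is precisely the j-th conjunct of ρ: input-enabledness on ⋆
-- turns "has no matching broadcast receive" into "¬ π".
module Submission where

open import Defs
open import Data.Nat using (ℕ; zero; suc)
open import Data.Fin using (Fin; zero; suc)
open import Data.Fin.Properties using (suc-injective; ∀-cons-⇔)
open import Data.Product using (Σ; ∃; _×_; _,_)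
open import Data.Product.Function.NonDependent.Propositional using (_×-⇔_)
open import Data.Sum using (_⊎_; inj₁; inj₂)
open import Data.Sum.Function.Propositional using (_⊎-⇔_)
open import Data.Empty using (⊥-elim)
open import Relation.Nullary using (¬_)
open import Relation.Binary.PropositionalEquality using (_≡_; _≢_; refl; sym; subst; cong)
open import Function using (_∘_; _$_)
open import Function.Bundles using (_⇔_; mk⇔; Equivalence)
open import Function.Construct.Identity using (⇔-id)
open import Function.Construct.Symmetry using (⇔-sym)
open import Function.Construct.Composition using (_⇔-∘_)
open import Level using (Level; lift)

open Equivalence using (to; from)

OneAndRest : ∀ {ℓ n} → (Fin n → Set ℓ) → (Fin n → Set ℓ) → Set ℓ
OneAndRest {n = n} P Q = Σ (Fin n) λ k → P k × (∀ j → j ≢ k → Q j)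

module _ {ℓ : Level} where

  oneAndRest-one⇔ : (P Q : Fin 1 → Set ℓ) → OneAndRest P Q ⇔ P zero
  oneAndRest-one⇔ P Q =
    mk⇔ (λ { (zero , p , _) → p }) (λ p → zero , p , λ { zero ne → ⊥-elim (ne refl) })

  oneAndRest-suc⇔ : ∀ {n} (P Q : Fin (suc n) → Set ℓ) →
    OneAndRest P Q ⇔ ((P zero × (∀ j → Q (suc j))) ⊎ (Q zero × OneAndRest (P ∘ suc) (Q ∘ suc)))
  oneAndRest-suc⇔ P Q = mk⇔ split join
    where
    split : OneAndRest P Q → (P zero × (∀ j → Q (suc j))) ⊎ (Q zero × OneAndRest (P ∘ suc) (Q ∘ suc))
    split (zero  , p , q) = inj₁ (p , λ j → q (suc j) λ ())
    split (suc k , p , q) = inj₂ (q zero (λ ()) , k , p , λ j ne → q (suc j) (ne ∘ suc-injective))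

    join : (P zero × (∀ j → Q (suc j))) ⊎ (Q zero × OneAndRest (P ∘ suc) (Q ∘ suc)) → OneAndRest P Q
    join (inj₁ (p , q)) = zero , p , λ { zero ne → ⊥-elim (ne refl) ; (suc j) _ → q j }
    join (inj₂ (q₀ , k , p , q)) = suc k , p , λ { zero _ → q₀ ; (suc j) ne → q j (ne ∘ cong suc) }

module Composition (Ch : Set) (⋆ : Ch) (M : Set₁) where
  open CTSs Ch ⋆ M
  open CTS

  Reacts : (T : CTS) → M → Ch → State T → State T → Set₁
  Reacts T υ c x x' = R T x υ rcv c x'
                    ⊎ (¬ ls T x c × x ≡ x')
                    ⊎ (c ≡ ⋆ × x ≡ x' × ¬ (∃ λ t → R T x υ rcv c t))

  module _ (T₁ T₂ : CTS) (υ : M) (c : Ch) where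

    ∥-send⇔ : ∀ {x₁ x₂ x₁' x₂'} →
      R (T₁ ∥ T₂) (x₁ , x₂) υ snd c (x₁' , x₂')
        ⇔ ((R T₁ x₁ υ snd c x₁' × Reacts T₂ υ c x₂ x₂') ⊎ (Reacts T₁ υ c x₁ x₁' × R T₂ x₂ υ snd c x₂'))
    ∥-send⇔ = mk⇔ split join
      where
      split : ∀ {x₁ x₂ x₁' x₂'} → R (T₁ ∥ T₂) (x₁ , x₂) υ snd c (x₁' , x₂') →
        (R T₁ x₁ υ snd c x₁' × Reacts T₂ υ c x₂ x₂') ⊎ (Reacts T₁ υ c x₁ x₁' × R T₂ x₂ υ snd c x₂')
      split (inj₁ (a , b))                                  = inj₁ (a , inj₁ b)
      split (inj₂ (inj₁ (a , b)))                           = inj₂ (inj₁ a , b)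
      split (inj₂ (inj₂ (inj₁ (a , ¬l , e))))               = inj₁ (a , inj₂ (inj₁ (¬l , e)))
      split (inj₂ (inj₂ (inj₂ (inj₁ (¬l , e , b)))))        = inj₂ (inj₂ (inj₁ (¬l , e)) , b)
      split (inj₂ (inj₂ (inj₂ (inj₂ (c⋆ , inj₁ (a , e , ¬r)))))) = inj₁ (a , inj₂ (inj₂ (c⋆ , e , ¬r)))
      split (inj₂ (inj₂ (inj₂ (inj₂ (c⋆ , inj₂ (b , e , ¬r)))))) = inj₂ (inj₂ (inj₂ (c⋆ , e , ¬r)) , b)

      join : ∀ {x₁ x₂ x₁' x₂'} →
        (R T₁ x₁ υ snd c x₁' × Reacts T₂ υ c x₂ x₂') ⊎ (Reacts T₁ υ c x₁ x₁' × R T₂ x₂ υ snd c x₂') →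
        R (T₁ ∥ T₂) (x₁ , x₂) υ snd c (x₁' , x₂')
      join (inj₁ (a , inj₁ b))                       = inj₁ (a , b)
      join (inj₁ (a , inj₂ (inj₁ (¬l , e))))         = inj₂ (inj₂ (inj₁ (a , ¬l , e)))
      join (inj₁ (a , inj₂ (inj₂ (c⋆ , e , ¬r))))    = inj₂ (inj₂ (inj₂ (inj₂ (c⋆ , inj₁ (a , e , ¬r)))))
      join (inj₂ (inj₁ a , b))                       = inj₂ (inj₁ (a , b))
      join (inj₂ (inj₂ (inj₁ (¬l , e)) , b))         = inj₂ (inj₂ (inj₂ (inj₁ (¬l , e , b))))
      join (inj₂ (inj₂ (inj₂ (c⋆ , e , ¬r)) , b))    = inj₂ (inj₂ (inj₂ (inj₂ (c⋆ , inj₂ (b , e , ¬r)))))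

    ∥-reacts⇔ : ∀ {x₁ x₂ x₁' x₂'} →
      Reacts (T₁ ∥ T₂) υ c (x₁ , x₂) (x₁' , x₂') ⇔ (Reacts T₁ υ c x₁ x₁' × Reacts T₂ υ c x₂ x₂')
    ∥-reacts⇔ = mk⇔ split join
      where
      split : ∀ {x₁ x₂ x₁' x₂'} → Reacts (T₁ ∥ T₂) υ c (x₁ , x₂) (x₁' , x₂') →
        Reacts T₁ υ c x₁ x₁' × Reacts T₂ υ c x₂ x₂'
      split (inj₁ (inj₁ (a , b)))                         = inj₁ a , inj₁ b
      split (inj₁ (inj₂ (inj₁ (a , ¬l , e))))             = inj₁ a , inj₂ (inj₁ (¬l , e))
      split (inj₁ (inj₂ (inj₂ (inj₁ (¬l , e , b)))))      = inj₂ (inj₁ (¬l , e)) , inj₁ b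
      split (inj₁ (inj₂ (inj₂ (inj₂ (c⋆ , inj₁ (a , e , ¬r)))))) = inj₁ a , inj₂ (inj₂ (c⋆ , e , ¬r))
      split (inj₁ (inj₂ (inj₂ (inj₂ (c⋆ , inj₂ (b , e , ¬r)))))) = inj₂ (inj₂ (c⋆ , e , ¬r)) , inj₁ b
      split (inj₂ (inj₁ (¬l , refl))) = inj₂ (inj₁ (¬l ∘ inj₁ , refl)) , inj₂ (inj₁ (¬l ∘ inj₂ , refl))
      split {x₁} {x₂} (inj₂ (inj₂ (c⋆ , refl , ¬r))) =
        inj₂ (inj₂ (c⋆ , refl , ¬r₁)) , inj₂ (inj₂ (c⋆ , refl , ¬r₂))
        where
        -- a receive of one component is one of the composition:
        -- jointly if the other can receive too, alone otherwise
        ¬r₁ : ¬ (∃ λ t → R T₁ x₁ υ rcv c t)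
        ¬r₁ (t₁ , r₁) = ¬r ((t₁ , x₂) , inj₂ (inj₂ (inj₂ (c⋆ , inj₁ (r₁ , refl ,
                           λ (t₂ , r₂) → ¬r ((t₁ , t₂) , inj₁ (r₁ , r₂)))))))
        ¬r₂ : ¬ (∃ λ t → R T₂ x₂ υ rcv c t)
        ¬r₂ (t₂ , r₂) = ¬r ((x₁ , t₂) , inj₂ (inj₂ (inj₂ (c⋆ , inj₂ (r₂ , refl ,
                           λ (t₁ , r₁) → ¬r ((t₁ , t₂) , inj₁ (r₁ , r₂)))))))

      -- Mixed "not listening" / "broadcast" cases are impossible: every state listens on ⋆.
      join : ∀ {x₁ x₂ x₁' x₂'} → Reacts T₁ υ c x₁ x₁' × Reacts T₂ υ c x₂ x₂' →
        Reacts (T₁ ∥ T₂) υ c (x₁ , x₂) (x₁' , x₂')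
      join (inj₁ a , inj₁ b)                       = inj₁ (inj₁ (a , b))
      join (inj₁ a , inj₂ (inj₁ (¬l , e)))         = inj₁ (inj₂ (inj₁ (a , ¬l , e)))
      join (inj₁ a , inj₂ (inj₂ (c⋆ , e , ¬r)))    = inj₁ (inj₂ (inj₂ (inj₂ (c⋆ , inj₁ (a , e , ¬r)))))
      join (inj₂ (inj₁ (¬l , e)) , inj₁ b)         = inj₁ (inj₂ (inj₂ (inj₁ (¬l , e , b))))
      join (inj₂ (inj₂ (c⋆ , e , ¬r)) , inj₁ b)    = inj₁ (inj₂ (inj₂ (inj₂ (c⋆ , inj₂ (b , e , ¬r)))))
      join (inj₂ (inj₁ (¬l₁ , refl)) , inj₂ (inj₁ (¬l₂ , refl))) =
        inj₂ (inj₁ ((λ { (inj₁ l) → ¬l₁ l ; (inj₂ l) → ¬l₂ l }) , refl))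
      join {x₁} (inj₂ (inj₁ (¬l , _)) , inj₂ (inj₂ (c⋆ , _ , _))) =
        ⊥-elim (¬l (subst (ls T₁ x₁) (sym c⋆) (ls⋆ T₁ x₁)))
      join {x₂ = x₂} (inj₂ (inj₂ (c⋆ , _ , _)) , inj₂ (inj₁ (¬l , _))) =
        ⊥-elim (¬l (subst (ls T₂ x₂) (sym c⋆) (ls⋆ T₂ x₂)))
      join (inj₂ (inj₂ (c⋆ , refl , ¬r₁)) , inj₂ (inj₂ (_ , refl , ¬r₂))) =
        inj₂ (inj₂ (c⋆ , refl , λ
          { (_ , inj₁ (r₁ , _))                           → ¬r₁ (_ , r₁)
          ; (_ , inj₂ (inj₁ (r₁ , _)))                    → ¬r₁ (_ , r₁)
          ; (_ , inj₂ (inj₂ (inj₁ (_ , _ , r₂))))         → ¬r₂ (_ , r₂)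
          ; (_ , inj₂ (inj₂ (inj₂ (_ , inj₁ (r₁ , _)))))  → ¬r₁ (_ , r₁)
          ; (_ , inj₂ (inj₂ (inj₂ (_ , inj₂ (r₂ , _)))))  → ¬r₂ (_ , r₂) }))

  ∥[]-init⇔ : ∀ n (T : Fin (suc n) → CTS) (s : (i : Fin (suc n)) → State (T i)) →
    (∀ i → Init (T i) (s i)) ⇔ Init (∥[ n ] T) (pack n T s)
  ∥[]-init⇔ zero    T s = mk⇔ (_$ zero) (λ { h zero → h })
  ∥[]-init⇔ (suc n) T s = (⇔-id _ ×-⇔ ∥[]-init⇔ n (T ∘ suc) (s ∘ suc)) ⇔-∘ ⇔-sym ∀-cons-⇔

  ∥[]-reacts⇔ : ∀ n (T : Fin (suc n) → CTS) υ c (s s' : (i : Fin (suc n)) → State (T i)) →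
    Reacts (∥[ n ] T) υ c (pack n T s) (pack n T s') ⇔ (∀ i → Reacts (T i) υ c (s i) (s' i))
  ∥[]-reacts⇔ zero    T υ c s s' = mk⇔ (λ { h zero → h }) (_$ zero)
  ∥[]-reacts⇔ (suc n) T υ c s s' =
    ∀-cons-⇔ ⇔-∘ ((⇔-id _ ×-⇔ ∥[]-reacts⇔ n (T ∘ suc) υ c (s ∘ suc) (s' ∘ suc))
                  ⇔-∘ ∥-reacts⇔ (T zero) (∥[ n ] (T ∘ suc)) υ c)

  ∥[]-send⇔ : ∀ n (T : Fin (suc n) → CTS) υ c (s s' : (i : Fin (suc n)) → State (T i)) →
    R (∥[ n ] T) (pack n T s) υ snd c (pack n T s')
      ⇔ OneAndRest (λ k → R (T k) (s k) υ snd c (s' k)) (λ j → Reacts (T j) υ c (s j) (s' j))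
  ∥[]-send⇔ zero    T υ c s s' = ⇔-sym (oneAndRest-one⇔ _ _)
  ∥[]-send⇔ (suc n) T υ c s s' =
    ⇔-sym (oneAndRest-suc⇔ _ _)
      ⇔-∘ (((⇔-id _ ×-⇔ ∥[]-reacts⇔ n (T ∘ suc) υ c (s ∘ suc) (s' ∘ suc))
            ⊎-⇔ (⇔-id _ ×-⇔ ∥[]-send⇔ n (T ∘ suc) υ c (s ∘ suc) (s' ∘ suc)))
           ⇔-∘ ∥-send⇔ (T zero) (∥[ n ] (T ∘ suc)) υ c)

module AgentSemantics (CVA DA Ch : Set) (⋆ : Ch) (n : ℕ) where
  open Agents CVA DA Ch ⋆ n
  open Composition Ch ⋆ Msg
  open Agent

  Receives : (A : Agent) → DA → (CVA → Set) → Ch → St A → St A → Set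
  Receives A d π ch x x' = Σ CVA λ cv → cv ≡ f A x ×
    ( (gr A x ch × Tr A x x' d ch × π cv)
    ⊎ (¬ gr A x ch × x ≡ x')
    ⊎ (ch ≡ ⋆ × ¬ π cv × x ≡ x'))

  ⟦⟧-reacts⇔ : (A : Agent) {j k : I} → j ≢ k → ∀ {d π ch x x'} →
    Reacts (⟦ A ⟧ j) (d , k , π) ch x x' ⇔ Receives A d π ch x x'
  ⟦⟧-reacts⇔ A {j} {k} j≢k {d} {π} {x = x} = mk⇔ split join
    where
    k≢j : k ≢ j
    k≢j = j≢k ∘ sym

    split : ∀ {ch x'} → Reacts (⟦ A ⟧ j) (d , k , π) ch x x' → Receives A d π ch x x'
    split (inj₁ (lift (tr , _ , g , p)))  = _ , refl , inj₁ (g , tr , p)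
    split (inj₂ (inj₁ (¬g , e)))          = _ , refl , inj₂ (inj₁ (¬g , e))
    split (inj₂ (inj₂ (refl , e , ¬r)))   = _ , refl , inj₂ (inj₂ (refl , ¬π , e))
      where
      ¬π : ¬ π (f A x)
      ¬π p = let (t , tr) = Tr-en A x d in ¬r (t , lift (tr , k≢j , gr⋆ A x , p))

    join : ∀ {ch x'} → Receives A d π ch x x' → Reacts (⟦ A ⟧ j) (d , k , π) ch x x'
    join (_ , refl , inj₁ (g , tr , p))     = inj₁ (lift (tr , k≢j , g , p))
    join (_ , refl , inj₂ (inj₁ (¬g , e)))  = inj₂ (inj₁ (¬g , e))
    join (_ , refl , inj₂ (inj₂ (c⋆ , ¬π , e))) =
      inj₂ (inj₂ (c⋆ , e , λ (_ , lift (_ , _ , _ , p)) → ¬π p))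

  module _ (A : I → Agent) where

    private
      T : I → CTS
      T i = ⟦ A i ⟧ i

    θS⇔Init : ∀ s → θS A s ⇔ CTS.Init (sys A) (toState A s)
    θS⇔Init = ∥[]-init⇔ n T

    SendStep : Glob A → Glob A → Set₁
    SendStep s s' = Σ DA λ d → Σ Ch λ ch → Σ I λ i →
      CTS.R (sys A) (toState A s) (d , i , gs (A i) (s i) ch d) snd ch (toState A s')

    ρ⇔SendStep : ∀ s s' → ρ A s s' ⇔ SendStep s s'
    ρ⇔SendStep s s' = mk⇔ toSend fromSend
      where
      toSend : ρ A s s' → SendStep s s'
      toSend (ch , d , k , ts , rest) = d , ch , k , from (∥[]-send⇔ n T _ ch s s')
        (k , (lift (ts , refl) , refl) , λ j j≢k → from (⟦⟧-reacts⇔ (A j) j≢k) (rest j j≢k))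

      fromSend : SendStep s s' → ρ A s s'
      fromSend (d , ch , i , r) with to (∥[]-send⇔ n T _ ch s s') r
      ... | k , (lift (ts , refl) , _) , rest =
        ch , d , k , ts , λ j j≢k → to (⟦⟧-reacts⇔ (A j) j≢k) (rest j j≢k)

mainTheorem7 : (CVA DA Ch : Set) (⋆ : Ch) (n : ℕ) →
    let open Agents CVA DA Ch ⋆ n in
    (A : I → Agent) →
      (∀ (s : Glob A) → θS A s ⇔ CTS.Init (sys A) (toState A s))
      × (∀ (s s' : Glob A) →
           ρ A s s' ⇔
             (Σ DA λ d → Σ Ch λ ch → Σ I λ i →
                CTS.R (sys A) (toState A s) (d , i , Agent.gs (A i) (s i) ch d) snd ch (toState A s')))
mainTheorem7 CVA DA Ch ⋆ n A = θS⇔Init A , ρ⇔SendStep A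
  where open AgentSemantics CVA DA Ch ⋆ n
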